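{- Let $R$ be a commutative ring and let $G_1,G_2$ be connected edge labeled graphs over $R$, each satisfying the Universal Difference Property, with $V(G_1)\cap V(G_2)=\{z\}$. Let $G=G_1\cup G_2$ be the graph obtained by pasting $G_1$ and $G_2$ at $z$, with edge labeling $\alpha$ restricting to the given labelings. Then $(G,\alpha)$ satisfies the Universal Difference Property if and only if for all $u\in V(G_1)$ and $w\in V(G_2)$, $$\bigcap_{P\in\mathcal{P}_{(u,w)}}\alpha(P)=\Big(\bigcap_{P\in\mathcal{P}_{(u,z)}}\alpha(P)\Big)+\Big(\bigcap_{P\in\mathcal{P}_{(z,w)}}\alpha(P)\Big),$$ where all paths are taken in $G$.
   Context: Graphs are finite. An edge labeling of a graph $G=(V,E)$ over a commutative ring $R$ is a function $\alpha:E\to\mathcal{I}(R)$ assigning to each edge an ideal of $R$. A (generalized) spline on $(G,\alpha)$ is a function $\rho:V\to R$ such that for each edge $ab$, $\rho(a)-\rho(b)\in\alpha(ab)$. For vertices $u,w$, $\mathcal{P}_{(u,w)}$ denotes the set of all paths from $u$ to $w$, and for a path $P$ with edges $e_1,\dots,e_k$, $\alpha(P)=\alpha(e_1)+\cdots+\alpha(e_k)$. An edge labeled graph satisfies the Universal Difference Property (UDP) if for every pair of vertices $u,w$ connected by a path and every $x\in\bigcap_{P\in\mathcal{P}_{(u,w)}}\alpha(P)$ there exists a spline $\rho$ with $\rho(u)-\rho(w)=x$. -}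

module Defs where

open import Level using (Level; _⊔_; suc)
open import Algebra.Bundles using (CommutativeRing)
open import Data.Nat using (ℕ)
open import Data.Fin using (Fin; _≟_)
open import Data.Sum using (_⊎_; inj₁; inj₂)
open import Data.Product using (Σ; _×_; _,_; ∃; ∃-syntax)
open import Data.List using (List; []; _∷_)
open import Data.List.Relation.Unary.Unique.Propositional using (Unique)
open import Relation.Binary.PropositionalEquality using (_≡_; _≢_)
open import Relation.Nullary using (¬_; yes; no)
open import Relation.Nullary.Decidable using (False; fromWitnessFalse)

module _ {c ℓ : Level} (R : CommutativeRing c ℓ) where
  open CommutativeRing R

  record Ideal (p : Level) : Set (c ⊔ ℓ ⊔ suc p) where
    field
      _∈I       : Carrier → Set p
      ∈-resp-≈  : ∀ {x y} → x ≈ y → x ∈I → y ∈I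
      0∈        : 0# ∈I
      +-closed  : ∀ {x y} → x ∈I → y ∈I → (x + y) ∈I
      *-closed  : ∀ r {x} → x ∈I → (r * x) ∈I

_∈ᵢ_ : ∀ {c ℓ p} {R : CommutativeRing c ℓ} →
       CommutativeRing.Carrier R → Ideal R p → Set p
x ∈ᵢ I = Ideal._∈I I x
infix 4 _∈ᵢ_

record LGraph {c ℓ : Level} (R : CommutativeRing c ℓ) (p : Level)
              : Set (c ⊔ ℓ ⊔ suc p) where
  field
    V   : Set
    E   : Set
    src : E → V
    tgt : E → V
    α   : E → Ideal R p

module _ {c ℓ p : Level} {R : CommutativeRing c ℓ} (G : LGraph R p) where
  open CommutativeRing R
  open LGraph G

  -- e joins u and v (edges are undirected)
  Joins : E → V → V → Set
  Joins e u v = (src e ≡ u × tgt e ≡ v) ⊎ (src e ≡ v × tgt e ≡ u)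

  data Walk : V → V → Set where
    []   : ∀ {v} → Walk v v
    step : ∀ {u v w} (e : E) → Joins e u v → Walk v w → Walk u w

  vertices : ∀ {u w} → Walk u w → List V
  vertices {u} []               = u ∷ []
  vertices {u} (step e _ rest)  = u ∷ vertices rest

  Path : V → V → Set
  Path u w = Σ (Walk u w) (λ W → Unique (vertices W))

  -- membership in α(P) = α(e₁) + ... + α(e_k)  (the zero ideal for k = 0)
  _∈αW_ : ∀ {u w} → Carrier → Walk u w → Set (c ⊔ ℓ ⊔ p)
  x ∈αW []              = Level.Lift (c ⊔ ℓ ⊔ p) (x ≈ 0#)
  x ∈αW (step e _ rest) = ∃[ a ] ∃[ b ] (a ∈ᵢ α e × b ∈αW rest × x ≈ a + b)

  _∈αP_ : ∀ {u w} → Carrier → Path u w → Set (c ⊔ ℓ ⊔ p)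
  x ∈αP (W , _) = x ∈αW W

  InPathsIdeal : V → V → Carrier → Set (c ⊔ ℓ ⊔ p)
  InPathsIdeal u w x = (P : Path u w) → x ∈αP P

  IsSpline : (V → Carrier) → Set p
  IsSpline ρ = (e : E) → (ρ (src e) - ρ (tgt e)) ∈ᵢ α e

  Connected : Set
  Connected = (u w : V) → Path u w

  UDP : Set (c ⊔ ℓ ⊔ p)
  UDP = (u w : V) → Path u w → (x : Carrier) → InPathsIdeal u w x →
        ∃[ ρ ] (IsSpline ρ × (ρ u - ρ w) ≈ x)

record FinLGraph {c ℓ : Level} (R : CommutativeRing c ℓ) (p : Level)
                 : Set (c ⊔ ℓ ⊔ suc p) where
  field
    n   : ℕ
    m   : ℕ
    src : Fin m → Fin n
    tgt : Fin m → Fin n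
    α   : Fin m → Ideal R p

  toLGraph : LGraph R p
  toLGraph = record { V = Fin n ; E = Fin m ; src = src ; tgt = tgt ; α = α }

  Simple : Set
  Simple = ((e : Fin m) → src e ≢ tgt e)
         × ((e f : Fin m) → Joins toLGraph f (src e) (tgt e) → e ≡ f)
open FinLGraph public using (toLGraph; Simple)

-- Pasting G₁ and G₂ at a vertex: z₁ ∈ V(G₁) is identified with
-- z₂ ∈ V(G₂); all other vertices are distinct.

module Paste {c ℓ p : Level} {R : CommutativeRing c ℓ}
             (G₁ G₂ : FinLGraph R p)
             (z₁ : Fin (FinLGraph.n G₁)) (z₂ : Fin (FinLGraph.n G₂)) where
  private
    module G₁ = FinLGraph G₁
    module G₂ = FinLGraph G₂

  PV : Set
  PV = Fin G₁.n ⊎ Σ (Fin G₂.n) (λ v → False (v ≟ z₂))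

  ι₁ : Fin G₁.n → PV
  ι₁ = inj₁

  ι₂ : Fin G₂.n → PV
  ι₂ v with v ≟ z₂
  ... | yes _  = inj₁ z₁
  ... | no v≢z = inj₂ (v , fromWitnessFalse v≢z)

  psrc : Fin G₁.m ⊎ Fin G₂.m → PV
  psrc (inj₁ e) = ι₁ (G₁.src e)
  psrc (inj₂ e) = ι₂ (G₂.src e)

  ptgt : Fin G₁.m ⊎ Fin G₂.m → PV
  ptgt (inj₁ e) = ι₁ (G₁.tgt e)
  ptgt (inj₂ e) = ι₂ (G₂.tgt e)

  pα : Fin G₁.m ⊎ Fin G₂.m → Ideal R p
  pα (inj₁ e) = G₁.α e
  pα (inj₂ e) = G₂.α e

  pasted : LGraph R p
  pasted = record { V = PV ; E = Fin G₁.m ⊎ Fin G₂.m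
                  ; src = psrc ; tgt = ptgt ; α = pα }

module _ {c ℓ : Level} (R : CommutativeRing c ℓ) where
  open CommutativeRing R
  SumMem : ∀ {q} → (Carrier → Set q) → (Carrier → Set q) → Carrier → Set (c ⊔ ℓ ⊔ q)
  SumMem A B x = ∃[ a ] ∃[ b ] (A a × B b × x ≈ a + b)

{-# OPTIONS --safe #-}
-- The pasting vertex z is a cut vertex: every path from G₁ to G₂ passes through it, so
-- α(P) for such a path is α of its G₁-part plus α of its G₂-part, and a spline on G is the
-- same thing as a pair of splines on G₁ and G₂ agreeing at z.  If G has the UDP, a spline ρ
-- with ρ u - ρ w = x splits x as (ρ u - ρ z) + (ρ z - ρ w), and each summand lies in the
-- corresponding path ideal.  Conversely, given such a splitting x = a + b, the UDP of G₁ and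
-- of G₂ realize a and b by splines; shifting the second by a constant makes them agree at z,
-- and gluing them realizes x.  Pairs of vertices on the same side are realized by extending a
-- spline of that side by a constant.
module Submission where

open import Defs
open import Level using (Level; _⊔_; lift)
open import Algebra.Bundles using (CommutativeRing)
open import Data.Fin using (Fin; _≟_)
open import Data.Bool.Properties using (T-irrelevant)
open import Data.Empty using (⊥-elim)
open import Data.List.Membership.Propositional using (_∈_)
open import Data.List.Relation.Unary.All using ([])
open import Data.List.Relation.Unary.All.Properties.Core using (¬Any⇒All¬)
open import Data.List.Relation.Unary.AllPairs using ([]; _∷_)
open import Data.List.Relation.Unary.Any using (here; there)
open import Data.Product using (Σ; _×_; _,_; ∃; ∃-syntax; proj₁; proj₂)
import Data.Product.Properties as Product
open import Data.Sum using (_⊎_; inj₁; inj₂; swap)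
import Data.Sum.Properties as Sum
open import Function.Bundles using (_⇔_; mk⇔; Equivalence)
open import Relation.Binary.Definitions using (DecidableEquality)
open import Relation.Binary.PropositionalEquality as ≡ using (_≡_; _≢_; refl)
open import Relation.Nullary using (yes; no)
open import Relation.Nullary.Decidable using (False; toWitnessFalse)

module RingIdentities {c ℓ : Level} (R : CommutativeRing c ℓ) where
  open CommutativeRing R hiding (refl)
  open import Algebra.Properties.AbelianGroup +-abelianGroup using (⁻¹-anti-homo‿-; ⁻¹-∙-comm)
  open import Algebra.Properties.Ring ring using (-1*x≈-x)
  open import Algebra.Solver.CommutativeMonoid +-commutativeMonoid
    using (solve; _⊜_; _⊕_)
  open import Relation.Binary.Reasoning.Setoid setoid
  private module R = CommutativeRing R

  x+[y-y]≈x : ∀ x y → x + (y - y) ≈ x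
  x+[y-y]≈x x y = trans (+-congˡ (-‿inverseʳ y)) (+-identityʳ x)

  x-z≈[x-y]+[y-z] : ∀ x y z → x - z ≈ (x - y) + (y - z)
  x-z≈[x-y]+[y-z] x y z = sym (begin
    (x + - y) + (y + - z)  ≈⟨ solve 4 (λ x -y y -z → (x ⊕ -y) ⊕ (y ⊕ -z) ⊜ (x ⊕ -z) ⊕ (y ⊕ -y))
                                      R.refl x (- y) y (- z) ⟩
    (x - z) + (y - y)      ≈⟨ x+[y-y]≈x (x - z) y ⟩
    x - z                  ∎)

  y+[x-y]≈x : ∀ x y → y + (x - y) ≈ x
  y+[x-y]≈x x y = begin
    y + (x + - y)  ≈⟨ solve 3 (λ x y -y → y ⊕ (x ⊕ -y) ⊜ x ⊕ (y ⊕ -y)) R.refl x y (- y) ⟩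
    x + (y - y)    ≈⟨ x+[y-y]≈x x y ⟩
    x              ∎

  [x+k]-[y+k]≈x-y : ∀ x y k → (x + k) - (y + k) ≈ x - y
  [x+k]-[y+k]≈x-y x y k = begin
    (x + k) + - (y + k)    ≈⟨ +-congˡ (sym (⁻¹-∙-comm y k)) ⟩
    (x + k) + (- y + - k)  ≈⟨ solve 4 (λ x k -y -k → (x ⊕ k) ⊕ (-y ⊕ -k) ⊜ (x ⊕ -y) ⊕ (k ⊕ -k))
                                      R.refl x k (- y) (- k) ⟩
    (x - y) + (k - k)      ≈⟨ x+[y-y]≈x (x - y) k ⟩
    x - y                  ∎

  [-x]-[-y]≈y-x : ∀ x y → (- x) - (- y) ≈ y - x
  [-x]-[-y]≈y-x x y = trans (⁻¹-∙-comm x (- y)) (⁻¹-anti-homo‿- x y)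

  ∈ᵢ-neg : ∀ {p} (I : Ideal R p) {x} → x ∈ᵢ I → (- x) ∈ᵢ I
  ∈ᵢ-neg I {x} x∈I = Ideal.∈-resp-≈ I (-1*x≈-x x) (Ideal.*-closed I (- 1#) x∈I)

module Walks {c ℓ p : Level} {R : CommutativeRing c ℓ} (G : LGraph R p) where
  open CommutativeRing R hiding (refl)
  open import Algebra.Properties.AbelianGroup +-abelianGroup using (⁻¹-anti-homo‿-)
  open RingIdentities R
  open LGraph G
  private module R = CommutativeRing R

  infix 4 _∈α_ _⊆α_
  infixr 5 _++_

  _∈α_ : ∀ {s t} → Carrier → Walk G s t → Set (c ⊔ ℓ ⊔ p)
  x ∈α W = _∈αW_ G x W

  _⊆α_ : ∀ {s t s′ t′} → Walk G s t → Walk G s′ t′ → Set (c ⊔ ℓ ⊔ p)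
  W ⊆α W′ = ∀ {x} → x ∈α W → x ∈α W′

  ∈α-resp-≈ : ∀ {s t} (W : Walk G s t) {x y} → x ≈ y → x ∈α W → y ∈α W
  ∈α-resp-≈ []           x≈y (lift x≈0)               = lift (R.trans (R.sym x≈y) x≈0)
  ∈α-resp-≈ (step _ _ _) x≈y (a , b , a∈ , b∈ , x≈a+b) =
    a , b , a∈ , b∈ , R.trans (R.sym x≈y) x≈a+b

  ⊆α-step : ∀ {s m t} e (j : Joins G e s m) (W : Walk G m t) → W ⊆α step e j W
  ⊆α-step e j W {x} x∈W = 0# , x , Ideal.0∈ (α e) , x∈W , R.sym (+-identityˡ x)

  _++_ : ∀ {s m t} → Walk G s m → Walk G m t → Walk G s t
  []           ++ W₂ = W₂
  step e j W₁ ++ W₂ = step e j (W₁ ++ W₂)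

  ∈α-++ : ∀ {s m t} (W₁ : Walk G s m) {W₂ : Walk G m t} {a b} →
          a ∈α W₁ → b ∈α W₂ → a + b ∈α W₁ ++ W₂
  ∈α-++ [] {W₂} {b = b} (lift a≈0) b∈W₂ =
    ∈α-resp-≈ W₂ (R.trans (R.sym (+-identityˡ b)) (+-congʳ (R.sym a≈0))) b∈W₂
  ∈α-++ (step e j W₁) {b = b} (c , d , c∈ , d∈W₁ , a≈c+d) b∈W₂ =
    c , d + b , c∈ , ∈α-++ W₁ d∈W₁ b∈W₂ , R.trans (+-congʳ a≈c+d) (+-assoc c d b)

  splitAt : ∀ {s m t} (W : Walk G s t) → m ∈ vertices G W →
            Σ (Walk G s m) λ W₁ → Σ (Walk G m t) λ W₂ → W₁ ++ W₂ ≡ W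
  splitAt []           (here refl) = [] , [] , refl
  splitAt (step e j W) (here refl) = [] , step e j W , refl
  splitAt (step e j W) (there m∈W) with splitAt W m∈W
  ... | W₁ , W₂ , refl = step e j W₁ , W₂ , refl

  reverseOnto : ∀ {m s t} → Walk G m s → Walk G m t → Walk G s t
  reverseOnto []           acc = acc
  reverseOnto (step e j W) acc = reverseOnto W (step e (swap j) acc)

  reverse : ∀ {s t} → Walk G s t → Walk G t s
  reverse W = reverseOnto W []

  ∈α-reverseOnto : ∀ {m s t} (W : Walk G m s) (acc : Walk G m t) {x} → x ∈α reverseOnto W acc →
                   ∃[ a ] ∃[ b ] (a ∈α W × b ∈α acc × x ≈ a + b)
  ∈α-reverseOnto [] acc {x} x∈acc = 0# , x , lift R.refl , x∈acc , R.sym (+-identityˡ x)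
  ∈α-reverseOnto (step e j W) acc x∈
    with ∈α-reverseOnto W (step e (swap j) acc) x∈
  ... | a , b , a∈W , (c , d , c∈ , d∈acc , b≈c+d) , x≈a+b =
    c + a , d , (c , a , c∈ , a∈W , R.refl) , d∈acc ,
    R.trans x≈a+b (R.trans (+-congˡ b≈c+d)
      (R.trans (R.sym (+-assoc a c d)) (+-congʳ (+-comm a c))))

  reverse-⊆α : ∀ {s t} (W : Walk G s t) → reverse W ⊆α W
  reverse-⊆α W x∈ with ∈α-reverseOnto W [] x∈
  ... | a , b , a∈W , lift b≈0 , x≈a+b =
    ∈α-resp-≈ W (R.sym (R.trans x≈a+b (R.trans (+-congˡ b≈0) (+-identityʳ a)))) a∈W

  spline-joins : ∀ {ρ} → IsSpline G ρ → ∀ {e u v} → Joins G e u v → ρ u - ρ v ∈ᵢ α e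
  spline-joins sp {e} (inj₁ (refl , refl)) = sp e
  spline-joins {ρ} sp {e} (inj₂ (refl , refl)) =
    Ideal.∈-resp-≈ (α e) (⁻¹-anti-homo‿- (ρ (src e)) (ρ (tgt e))) (∈ᵢ-neg (α e) (sp e))

  spline-diff∈α : ∀ {ρ} → IsSpline G ρ → ∀ {s t} (W : Walk G s t) → ρ s - ρ t ∈α W
  spline-diff∈α {ρ} sp {s} [] = lift (-‿inverseʳ (ρ s))
  spline-diff∈α {ρ} sp {s} {t} (step {v = m} e j W) =
    ρ s - ρ m , ρ m - ρ t , spline-joins sp j , spline-diff∈α sp W , x-z≈[x-y]+[y-z] (ρ s) (ρ m) (ρ t)

  spline-diff∈pathsIdeal : ∀ {ρ} → IsSpline G ρ → ∀ s t → InPathsIdeal G s t (ρ s - ρ t)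
  spline-diff∈pathsIdeal sp s t (W , _) = spline-diff∈α sp W

  const-spline : ∀ k → IsSpline G (λ _ → k)
  const-spline k e = Ideal.∈-resp-≈ (α e) (R.sym (-‿inverseʳ k)) (Ideal.0∈ (α e))

  shift-spline : ∀ {ρ} → IsSpline G ρ → ∀ k → IsSpline G (λ v → ρ v + k)
  shift-spline {ρ} sp k e =
    Ideal.∈-resp-≈ (α e) (R.sym ([x+k]-[y+k]≈x-y (ρ (src e)) (ρ (tgt e)) k)) (sp e)

  neg-spline : ∀ {ρ} → IsSpline G ρ → IsSpline G (λ v → - ρ v)
  neg-spline {ρ} sp e =
    Ideal.∈-resp-≈ (α e)
      (R.trans (⁻¹-anti-homo‿- (ρ (src e)) (ρ (tgt e))) (R.sym ([-x]-[-y]≈y-x (ρ (src e)) (ρ (tgt e)))))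
      (∈ᵢ-neg (α e) (sp e))

  Realizable : V → V → Carrier → Set (c ⊔ ℓ ⊔ p)
  Realizable s t x = ∃[ ρ ] (IsSpline G ρ × ρ s - ρ t ≈ x)

  realizable-sym : ∀ {s t x} → Realizable s t x → Realizable t s x
  realizable-sym {s} {t} (ρ , sp , ρs-ρt≈x) =
    (λ v → - ρ v) , neg-spline {ρ} sp , R.trans ([-x]-[-y]≈y-x (ρ t) (ρ s)) ρs-ρt≈x

  realizable⇒sum : ∀ {s t x} → Realizable s t x → ∀ m →
                   SumMem R (InPathsIdeal G s m) (InPathsIdeal G m t) x
  realizable⇒sum {s} {t} (ρ , sp , ρs-ρt≈x) m =
    ρ s - ρ m , ρ m - ρ t , spline-diff∈pathsIdeal sp s m , spline-diff∈pathsIdeal sp m t ,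
    R.trans (R.sym ρs-ρt≈x) (x-z≈[x-y]+[y-z] (ρ s) (ρ m) (ρ t))

  module _ (_≟V_ : DecidableEquality V) where
    open import Data.List.Membership.DecPropositional _≟V_ using (_∈?_)

    suffixPath : ∀ {s m t} (P : Path G s t) → m ∈ vertices G (proj₁ P) →
                 Σ (Path G m t) λ Q → proj₁ Q ⊆α proj₁ P
    suffixPath P@([] , _)         (here refl) = P , λ x∈ → x∈
    suffixPath P@(step _ _ _ , _) (here refl) = P , λ x∈ → x∈
    suffixPath (step e j W , _ ∷ W-unique) (there m∈W) with suffixPath (W , W-unique) m∈W
    ... | Q , Q⊆W = Q , λ x∈ → ⊆α-step e j W (Q⊆W x∈)

    walk⇒path : ∀ {s t} (W : Walk G s t) → Σ (Path G s t) λ P → proj₁ P ⊆α W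
    walk⇒path [] = ([] , [] ∷ []) , λ x∈ → x∈
    walk⇒path {s} (step e j W) with walk⇒path W
    ... | P , P⊆W with s ∈? vertices G (proj₁ P)
    ...   | yes s∈P = let Q , Q⊆P = suffixPath P s∈P in
                      Q , λ x∈ → ⊆α-step e j W (P⊆W (Q⊆P x∈))
    ...   | no  s∉P = (step e j (proj₁ P) , ¬Any⇒All¬ _ s∉P ∷ proj₂ P) ,
                      λ { (a , b , a∈ , b∈P , x≈a+b) → a , b , a∈ , P⊆W b∈P , x≈a+b }

    pathsIdeal⇒∈α : ∀ {s t x} → InPathsIdeal G s t x → (W : Walk G s t) → x ∈α W
    pathsIdeal⇒∈α x∈ W = proj₂ (walk⇒path W) (x∈ (proj₁ (walk⇒path W)))

    pathsIdeal-sym : ∀ {s t x} → InPathsIdeal G s t x → InPathsIdeal G t s x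
    pathsIdeal-sym x∈ (W , _) = reverse-⊆α W (pathsIdeal⇒∈α x∈ (reverse W))

    sum⊆pathsIdeal : ∀ {s m t x} → (∀ (W : Walk G s t) → m ∈ vertices G W) →
                     SumMem R (InPathsIdeal G s m) (InPathsIdeal G m t) x → InPathsIdeal G s t x
    sum⊆pathsIdeal through-m (a , b , a∈ , b∈ , x≈a+b) (W , _) with splitAt W (through-m W)
    ... | W₁ , W₂ , refl =
      ∈α-resp-≈ W (R.sym x≈a+b) (∈α-++ W₁ (pathsIdeal⇒∈α a∈ W₁) (pathsIdeal⇒∈α b∈ W₂))

module LabelPreservingMap {c ℓ p : Level} {R : CommutativeRing c ℓ} {G H : LGraph R p}
  (f : LGraph.V G → LGraph.V H) (g : LGraph.E G → LGraph.E H)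
  (src-g : ∀ e → LGraph.src H (g e) ≡ f (LGraph.src G e))
  (tgt-g : ∀ e → LGraph.tgt H (g e) ≡ f (LGraph.tgt G e))
  (α-g : ∀ e → LGraph.α H (g e) ≡ LGraph.α G e) where
  private
    module G = Walks G
    module H = Walks H

  map-joins : ∀ {e u v} → Joins G e u v → Joins H (g e) (f u) (f v)
  map-joins {e} (inj₁ (refl , refl)) = inj₁ (src-g e , tgt-g e)
  map-joins {e} (inj₂ (refl , refl)) = inj₂ (src-g e , tgt-g e)

  mapWalk : ∀ {s t} → Walk G s t → Walk H (f s) (f t)
  mapWalk []           = []
  mapWalk (step e j W) = step (g e) (map-joins j) (mapWalk W)

  ∈α-mapWalk : ∀ {s t} (W : Walk G s t) {x} → x H.∈α mapWalk W → x G.∈α W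
  ∈α-mapWalk []           x∈ = x∈
  ∈α-mapWalk (step e j W) (a , b , a∈ , b∈ , x≈a+b) =
    a , b , ≡.subst (a ∈ᵢ_) (α-g e) a∈ , ∈α-mapWalk W b∈ , x≈a+b

  pathsIdeal-reflect : DecidableEquality (LGraph.V H) → ∀ {s t x} →
                       InPathsIdeal H (f s) (f t) x → InPathsIdeal G s t x
  pathsIdeal-reflect _≟H_ x∈ (W , _) = ∈α-mapWalk W (H.pathsIdeal⇒∈α _≟H_ x∈ (mapWalk W))

module Pasting {c ℓ p : Level} {R : CommutativeRing c ℓ} (G₁ G₂ : FinLGraph R p)
               (z₁ : Fin (FinLGraph.n G₁)) (z₂ : Fin (FinLGraph.n G₂)) where
  open CommutativeRing R hiding (refl)
  open RingIdentities R
  open Paste G₁ G₂ z₁ z₂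
  open Walks pasted
  open import Relation.Binary.Reasoning.Setoid setoid
  private
    module R = CommutativeRing R
    module G₁ = FinLGraph G₁
    module G₂ = FinLGraph G₂
    H₁ = toLGraph G₁
    H₂ = toLGraph G₂

  ι₂-z₂ : ι₂ z₂ ≡ ι₁ z₁
  ι₂-z₂ with z₂ ≟ z₂
  ... | yes _   = refl
  ... | no z₂≢z₂ = ⊥-elim (z₂≢z₂ refl)

  ι₂≡inj₁⇒≡z₁ : ∀ {v y} → ι₂ v ≡ inj₁ y → y ≡ z₁
  ι₂≡inj₁⇒≡z₁ {v} eq with v ≟ z₂
  ι₂≡inj₁⇒≡z₁ refl | yes _ = refl
  ι₂≡inj₁⇒≡z₁ ()   | no _

  ι₂-inj₂ : ∀ y → ι₂ (proj₁ y) ≡ inj₂ y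
  ι₂-inj₂ y with proj₁ y ≟ z₂
  ... | yes y≡z₂ = ⊥-elim (toWitnessFalse (proj₂ y) y≡z₂)
  ... | no _     = ≡.cong (λ q → inj₂ (proj₁ y , q)) (T-irrelevant _ (proj₂ y))

  ι-cover : ∀ t → (∃ λ a → t ≡ ι₁ a) ⊎ (∃ λ b → t ≡ ι₂ b)
  ι-cover (inj₁ a) = inj₁ (a , refl)
  ι-cover (inj₂ y) = inj₂ (proj₁ y , ≡.sym (ι₂-inj₂ y))

  _≟P_ : DecidableEquality PV
  _≟P_ = Sum.≡-dec _≟_ (Product.≡-dec _≟_ λ q q′ → yes (T-irrelevant q q′))

  private
    module Embed₁ = LabelPreservingMap {G = H₁} {H = pasted} ι₁ inj₁
                      (λ _ → refl) (λ _ → refl) (λ _ → refl)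
    module Embed₂ = LabelPreservingMap {G = H₂} {H = pasted} ι₂ inj₂
                      (λ _ → refl) (λ _ → refl) (λ _ → refl)

  restrict₁ : ∀ {a b x} → InPathsIdeal pasted (ι₁ a) (ι₁ b) x → InPathsIdeal H₁ a b x
  restrict₁ = Embed₁.pathsIdeal-reflect _≟P_

  restrict₂ : ∀ {a b x} → InPathsIdeal pasted (ι₂ a) (ι₂ b) x → InPathsIdeal H₂ a b x
  restrict₂ = Embed₂.pathsIdeal-reflect _≟P_

  joins-inj₁ : ∀ e {v t} → Joins pasted e (inj₁ v) t → v ≢ z₁ → ∃ λ v′ → t ≡ inj₁ v′
  joins-inj₁ (inj₁ _) (inj₁ (_ , refl)) _    = _ , refl
  joins-inj₁ (inj₁ _) (inj₂ (refl , _)) _    = _ , refl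
  joins-inj₁ (inj₂ _) (inj₁ (eq , _))   v≢z₁ = ⊥-elim (v≢z₁ (ι₂≡inj₁⇒≡z₁ eq))
  joins-inj₁ (inj₂ _) (inj₂ (_ , eq))   v≢z₁ = ⊥-elim (v≢z₁ (ι₂≡inj₁⇒≡z₁ eq))

  z-separates : ∀ {v t w} (W : Walk pasted (inj₁ v) t) → t ≡ ι₂ w → ι₁ z₁ ∈ vertices pasted W
  z-separates {v} [] t≡ι₂w with ι₂≡inj₁⇒≡z₁ (≡.sym t≡ι₂w)
  ... | refl = here refl
  z-separates {v} (step e j W) t≡ι₂w with v ≟ z₁
  ... | yes refl = here refl
  ... | no v≢z₁ with joins-inj₁ e j v≢z₁
  ...   | _ , refl = there (z-separates W t≡ι₂w)

  glue : (Fin G₁.n → Carrier) → (Fin G₂.n → Carrier) → PV → Carrier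
  glue ρ₁ ρ₂ (inj₁ v)       = ρ₁ v
  glue ρ₁ ρ₂ (inj₂ (v , _)) = ρ₂ v

  module _ {ρ₁ : Fin G₁.n → Carrier} {ρ₂ : Fin G₂.n → Carrier} (agree : ρ₁ z₁ ≈ ρ₂ z₂) where

    glue-ι₂ : ∀ v → glue ρ₁ ρ₂ (ι₂ v) ≈ ρ₂ v
    glue-ι₂ v with v ≟ z₂
    ... | yes refl = agree
    ... | no _     = R.refl

    glue-diff₂ : ∀ u v → glue ρ₁ ρ₂ (ι₂ u) - glue ρ₁ ρ₂ (ι₂ v) ≈ ρ₂ u - ρ₂ v
    glue-diff₂ u v = +-cong (glue-ι₂ u) (-‿cong (glue-ι₂ v))

    glue-spline : IsSpline H₁ ρ₁ → IsSpline H₂ ρ₂ → IsSpline pasted (glue ρ₁ ρ₂)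
    glue-spline sp₁ sp₂ (inj₁ e) = sp₁ e
    glue-spline sp₁ sp₂ (inj₂ e) = Ideal.∈-resp-≈ (G₂.α e) (R.sym (glue-diff₂ _ _)) (sp₂ e)

  private
    module W₁ = Walks H₁
    module W₂ = Walks H₂

    SumVia : Fin G₁.n → Fin G₂.n → Carrier → PV → Set (c ⊔ ℓ ⊔ p)
    SumVia u w x m = SumMem R (InPathsIdeal pasted (ι₁ u) (ι₁ z₁)) (InPathsIdeal pasted m (ι₂ w)) x

  SumAtZ : Fin G₁.n → Fin G₂.n → Carrier → Set (c ⊔ ℓ ⊔ p)
  SumAtZ u w x = SumVia u w x (ι₂ z₂)

  IdealsSplitAtZ : Set (c ⊔ ℓ ⊔ p)
  IdealsSplitAtZ = ∀ u w {x} → InPathsIdeal pasted (ι₁ u) (ι₂ w) x → SumAtZ u w x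

  sumAtZ⊆pathsIdeal : ∀ u w {x} → SumAtZ u w x → InPathsIdeal pasted (ι₁ u) (ι₂ w) x
  sumAtZ⊆pathsIdeal u w {x} x∈ =
    sum⊆pathsIdeal _≟P_ (λ W → z-separates W refl) (≡.subst (SumVia u w x) ι₂-z₂ x∈)

  module _ (conn₁ : Connected H₁) (conn₂ : Connected H₂) where

    connecting-path : ∀ u w → Path pasted (ι₁ u) (ι₂ w)
    connecting-path u w = proj₁ (walk⇒path _≟P_ (u→z ++ ≡.subst (λ s → Walk pasted s (ι₂ w)) ι₂-z₂ z→w))
      where
        u→z = Embed₁.mapWalk (proj₁ (conn₁ u z₁))
        z→w = Embed₂.mapWalk (proj₁ (conn₂ z₂ w))

    udp⇒idealsSplitAtZ : UDP pasted → IdealsSplitAtZ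
    udp⇒idealsSplitAtZ udp u w {x} x∈ =
      ≡.subst (SumVia u w x) (≡.sym ι₂-z₂)
        (realizable⇒sum (udp (ι₁ u) (ι₂ w) (connecting-path u w) x x∈) (ι₁ z₁))

    module _ (udp₁ : UDP H₁) (udp₂ : UDP H₂) where

      realize₁₁ : ∀ a b x → InPathsIdeal pasted (ι₁ a) (ι₁ b) x → Realizable (ι₁ a) (ι₁ b) x
      realize₁₁ a b x x∈ with udp₁ a b (conn₁ a b) x (restrict₁ x∈)
      ... | ρ₁ , sp₁ , ρ₁-diff =
        glue ρ₁ (λ _ → ρ₁ z₁) , glue-spline R.refl sp₁ (W₂.const-spline (ρ₁ z₁)) , ρ₁-diff

      realize₂₂ : ∀ a b x → InPathsIdeal pasted (ι₂ a) (ι₂ b) x → Realizable (ι₂ a) (ι₂ b) x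
      realize₂₂ a b x x∈ with udp₂ a b (conn₂ a b) x (restrict₂ x∈)
      ... | ρ₂ , sp₂ , ρ₂-diff =
        glue (λ _ → ρ₂ z₂) ρ₂ , glue-spline R.refl (W₁.const-spline (ρ₂ z₂)) sp₂ ,
        R.trans (glue-diff₂ R.refl a b) ρ₂-diff

      realize₁₂ : IdealsSplitAtZ → ∀ a b x → InPathsIdeal pasted (ι₁ a) (ι₂ b) x → Realizable (ι₁ a) (ι₂ b) x
      realize₁₂ decompose a b x x∈ with decompose a b x∈
      ... | a′ , b′ , a′∈ , b′∈ , x≈a′+b′
        with udp₁ a z₁ (conn₁ a z₁) a′ (restrict₁ a′∈)
           | udp₂ z₂ b (conn₂ z₂ b) b′ (restrict₂ b′∈)
      ... | ρ₁ , sp₁ , ρ₁-diff | ρ₂ , sp₂ , ρ₂-diff =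
        glue ρ₁ ρ₂′ , glue-spline agree sp₁ (W₂.shift-spline {ρ₂} sp₂ k) , (begin
          ρ₁ a - glue ρ₁ ρ₂′ (ι₂ b)
            ≈⟨ x-z≈[x-y]+[y-z] (ρ₁ a) (ρ₁ z₁) _ ⟩
          (ρ₁ a - ρ₁ z₁) + (ρ₁ z₁ - glue ρ₁ ρ₂′ (ι₂ b))
            ≈⟨ +-cong ρ₁-diff (+-cong agree (-‿cong (glue-ι₂ agree b))) ⟩
          a′ + (ρ₂′ z₂ - ρ₂′ b)
            ≈⟨ +-congˡ (R.trans ([x+k]-[y+k]≈x-y (ρ₂ z₂) (ρ₂ b) k) ρ₂-diff) ⟩
          a′ + b′
            ≈⟨ R.sym x≈a′+b′ ⟩
          x ∎)
        where
          k = ρ₁ z₁ - ρ₂ z₂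
          ρ₂′ = λ v → ρ₂ v + k
          agree : ρ₁ z₁ ≈ ρ₂′ z₂
          agree = R.sym (y+[x-y]≈x (ρ₁ z₁) (ρ₂ z₂))

      idealsSplitAtZ⇒udp : IdealsSplitAtZ → UDP pasted
      idealsSplitAtZ⇒udp decompose t t′ _ x x∈ with ι-cover t | ι-cover t′
      ... | inj₁ (a , refl) | inj₁ (b , refl) = realize₁₁ a b x x∈
      ... | inj₂ (a , refl) | inj₂ (b , refl) = realize₂₂ a b x x∈
      ... | inj₁ (a , refl) | inj₂ (b , refl) = realize₁₂ decompose a b x x∈
      ... | inj₂ (a , refl) | inj₁ (b , refl) =
        realizable-sym (realize₁₂ decompose b a x (pathsIdeal-sym _≟P_ x∈))

mainTheorem7 : {c ℓ p : Level} (R : CommutativeRing c ℓ)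
    (G₁ G₂ : FinLGraph R p)
    (z₁ : Fin (FinLGraph.n G₁)) (z₂ : Fin (FinLGraph.n G₂)) →
    Simple G₁ → Simple G₂ →
    Connected (toLGraph G₁) → Connected (toLGraph G₂) →
    UDP (toLGraph G₁) → UDP (toLGraph G₂) →
    UDP (Paste.pasted G₁ G₂ z₁ z₂)
      ⇔ ((u : Fin (FinLGraph.n G₁)) (w : Fin (FinLGraph.n G₂))
          (x : CommutativeRing.Carrier R) →
          InPathsIdeal (Paste.pasted G₁ G₂ z₁ z₂) (Paste.ι₁ G₁ G₂ z₁ z₂ u) (Paste.ι₂ G₁ G₂ z₁ z₂ w) x
            ⇔ SumMem R
                (InPathsIdeal (Paste.pasted G₁ G₂ z₁ z₂) (Paste.ι₁ G₁ G₂ z₁ z₂ u) (Paste.ι₁ G₁ G₂ z₁ z₂ z₁))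
                (InPathsIdeal (Paste.pasted G₁ G₂ z₁ z₂) (Paste.ι₂ G₁ G₂ z₁ z₂ z₂) (Paste.ι₂ G₁ G₂ z₁ z₂ w))
                x)
mainTheorem7 R G₁ G₂ z₁ z₂ _ _ conn₁ conn₂ udp₁ udp₂ =
  mk⇔ (λ udp u w x → mk⇔ (udp⇒idealsSplitAtZ conn₁ conn₂ udp u w) (sumAtZ⊆pathsIdeal u w))
      (λ ideals-split → idealsSplitAtZ⇒udp conn₁ conn₂ udp₁ udp₂
                          (λ u w {x} → Equivalence.to (ideals-split u w x)))
  where open Pasting G₁ G₂ z₁ z₂
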